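{- Let $F$ be a Goldberg–Coxeter fullerene obtained from a fullerene $F_0$ by the Goldberg–Coxeter transformation $(k,l)$. Then the following hold. - The area of every facet of $F$ is an integer. - The square of every master edge of $F$ is an integer. - All these integers have the common factor $N_{kl}=k^2+kl+l^2$, the area scale factor of the transformation. Here the area of a facet with Coxeter coordinates $(k',l')$ and $(p,q)$ is $k'p+k'q+l'q$, and the square of a master edge with Coxeter coordinates $(a,b)$ is $a^2+ab+b^2$.
   Context: A fullerene is a 3-regular plane graph all of whose faces are pentagons or hexagons; there are exactly 12 pentagons. Its dual is a plane triangulation, which can be unfolded locally onto the Eisenstein plane. This is the complex plane with the triangular lattice $\{a+b\omega: a,b\in\mathbb{Z}\}$, where $\omega=e^{i\pi/3}$, so that $\omega^2=\omega-1$. The master polyhedron is the triangulated polyhedron whose vertices are the 12 pentagons. Its edges, the master edges, are lattice vectors $a+b\omega$ joining pentagon centers; their Coxeter coordinates are $(a,b)$ with $a,b\ge0$. Its triangular faces are called facets. A facet with two consecutive sides given by Coxeter coordinates $(k',l')$ and $(p,q)$ has side vectors $k'+l'\omega$ and $p\omega+q\omega^2=-q+(p+q)\omega$. Its (equivalent) area is the determinant $\det\begin{pmatrix}k'&l'\\-q&p+q\end{pmatrix}=k'p+k'q+l'q$. The area is normalized so that it counts carbon atoms, and the elementary patch $(1,0)$ has area $1$. The square of a master edge $(a,b)$ is $a^2+ab+b^2$, which is the area of the equilateral triangular patch having that edge. The Goldberg–Coxeter transformation $(k,l)$, with integers $k\ge1$ and $l\ge0$, multiplies every master edge vector by $k+l\omega$.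 Equivalently, it replaces each triangle of the dual by the graphene patch spanned by $k+l\omega$. A Goldberg–Coxeter fullerene is a fullerene obtained from some fullerene by a Goldberg–Coxeter transformation $(k,l)\neq(1,0)$. -}

module Defs where

open import Data.Nat as ℕ using (ℕ)
open import Data.Integer using (ℤ; +_; _+_; _-_; _*_; -_)
open import Data.Product using (_×_; _,_)

-- Eisenstein integers a + b ω (ω = e^{iπ/3}, ω² = ω - 1), stored as (a , b).
Eis : Set
Eis = ℤ × ℤ

-- multiplication: (a + bω)(c + dω) = (ac - bd) + (ad + bc + bd) ω
_·_ : Eis → Eis → Eis
(a , b) · (c , d) = (a * c - b * d , a * d + b * c + b * d)

coxVec : ℕ → ℕ → Eis
coxVec a b = (+ a , + b)

-- the vector p ω + q ω² = -q + (p + q) ω  (second side of a facet)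
coxVecRot : ℕ → ℕ → Eis
coxVecRot p q = (- (+ q) , + p + + q)

-- (equivalent) area of a facet with consecutive side vectors u , v :
-- the determinant of their coordinates in the basis (1 , ω)
area : Eis → Eis → ℤ
area (a , b) (c , d) = a * d - b * c

sq : Eis → ℤ
sq (a , b) = a * a + a * b + b * b

gc : ℕ → ℕ → Eis → Eis
gc k l u = coxVec k l · u

N : ℕ → ℕ → ℕ
N k l = k ℕ.* k ℕ.+ k ℕ.* l ℕ.+ l ℕ.* l

{-# OPTIONS --safe #-}
-- Multiplication by w in the Eisenstein integers scales the norm and every
-- oriented area by the norm of w, and the norm of k + l ω is N k l.  So after
-- the Goldberg–Coxeter transformation (k , l) every facet area and every master
-- edge square is N k l times the corresponding integer of the parent fullerene.
module Submission where

open import Defs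
open import Data.Nat using (ℕ; _≥_)
open import Data.Integer using (ℤ; +_)
open import Data.Integer.Divisibility using (_∣_)
open import Data.Product using (_×_; _,_)
open import Relation.Binary.PropositionalEquality using (_≢_; _≡_; refl; sym; cong; cong₂; subst; module ≡-Reasoning)
import Data.Nat as ℕ
import Data.Integer as ℤ
import Data.Integer.Properties as ℤ
import Data.Integer.Divisibility.Signed as Signed
open import Data.Integer.Tactic.RingSolver using (solve-∀)

sq-· : ∀ (u v : Eis) → sq (u · v) ≡ sq u ℤ.* sq v
sq-· (a , b) (c , d) = identity a b c d
  where
  identity : ∀ a b c d →
    let x = a ℤ.* c ℤ.- b ℤ.* d
        y = a ℤ.* d ℤ.+ b ℤ.* c ℤ.+ b ℤ.* d
    in x ℤ.* x ℤ.+ x ℤ.* y ℤ.+ y ℤ.* y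
      ≡ (a ℤ.* a ℤ.+ a ℤ.* b ℤ.+ b ℤ.* b) ℤ.* (c ℤ.* c ℤ.+ c ℤ.* d ℤ.+ d ℤ.* d)
  identity = solve-∀

area-· : ∀ (w u v : Eis) → area (w · u) (w · v) ≡ sq w ℤ.* area u v
area-· (k , l) (a , b) (c , d) = identity k l a b c d
  where
  identity : ∀ k l a b c d →
    (k ℤ.* a ℤ.- l ℤ.* b) ℤ.* (k ℤ.* d ℤ.+ l ℤ.* c ℤ.+ l ℤ.* d)
      ℤ.- (k ℤ.* b ℤ.+ l ℤ.* a ℤ.+ l ℤ.* b) ℤ.* (k ℤ.* c ℤ.- l ℤ.* d)
      ≡ (k ℤ.* k ℤ.+ k ℤ.* l ℤ.+ l ℤ.* l) ℤ.* (a ℤ.* d ℤ.- b ℤ.* c)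
  identity = solve-∀

sq-coxVec : ∀ k l → sq (coxVec k l) ≡ + N k l
sq-coxVec k l = begin
  + k ℤ.* + k ℤ.+ + k ℤ.* + l ℤ.+ + l ℤ.* + l
    ≡⟨ cong₂ ℤ._+_ (cong₂ ℤ._+_ (ℤ.pos-* k k) (ℤ.pos-* k l)) (ℤ.pos-* l l) ⟨
  + (k ℕ.* k) ℤ.+ + (k ℕ.* l) ℤ.+ + (l ℕ.* l)
    ≡⟨ cong (ℤ._+ + (l ℕ.* l)) (ℤ.pos-+ (k ℕ.* k) (k ℕ.* l)) ⟨
  + (k ℕ.* k ℕ.+ k ℕ.* l) ℤ.+ + (l ℕ.* l)
    ≡⟨ ℤ.pos-+ (k ℕ.* k ℕ.+ k ℕ.* l) (l ℕ.* l) ⟨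
  + N k l ∎
  where open ≡-Reasoning

x≡m*n⇒m∣x : ∀ {x} m n → x ≡ m ℤ.* n → m ∣ x
x≡m*n⇒m∣x m n refl = Signed.∣⇒∣ᵤ (Signed.∣m⇒∣m*n n (Signed.∣-refl {m}))

N∣sq-gc : ∀ k l u → + N k l ∣ sq (gc k l u)
N∣sq-gc k l u = subst (_∣ sq (gc k l u)) (sq-coxVec k l)
  (x≡m*n⇒m∣x (sq (coxVec k l)) (sq u) (sq-· (coxVec k l) u))

N∣area-gc : ∀ k l u v → + N k l ∣ area (gc k l u) (gc k l v)
N∣area-gc k l u v = subst (_∣ area (gc k l u) (gc k l v)) (sq-coxVec k l)
  (x≡m*n⇒m∣x (sq (coxVec k l)) (area u v) (area-· (coxVec k l) u v))

-- The divisibility holds for every (k , l).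
theorem3 : (k l : ℕ) → k ≥ 1 → (k , l) ≢ (1 , 0)
    → ((k′ l′ p q : ℕ) → (+ (N k l)) ∣ area (gc k l (coxVec k′ l′)) (gc k l (coxVecRot p q)))
      × ((a b : ℕ) → (+ (N k l)) ∣ sq (gc k l (coxVec a b)))
theorem3 k l _ _ =
    (λ k′ l′ p q → N∣area-gc k l (coxVec k′ l′) (coxVecRot p q))
  , (λ a b → N∣sq-gc k l (coxVec a b))
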